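{- Let $G$ be a graph with no induced $P_7$, $C_4$, $C_6$ or $C_7$, let $H=(B_1,\dots,B_5)$ be a nice blowup of $C_5$ in $G$, and let $v\in V(G)\setminus V(H)$. Then $\mathrm{supp}(v)$ consists of integers that are consecutive modulo $5$, and $|\mathrm{supp}(v)|\in\{0,1,2,3,5\}$.
   Context: Indices are modulo $5$. A tuple $(B_1,\dots,B_5)$ of pairwise disjoint nonempty vertex sets is a nice blowup of $C_5$ in $G$ if: each $B_i$ is a clique; every $v\in B_i$ has a neighbor in $B_{i-1}$ and in $B_{i+1}$; there are no edges between $B_i$ and $B_{i+2}$; and for every $i$, $a\in B_i$, distinct $b,c\in B_{i+1}$, $d\in B_{i+2}$, $G[\{a,b,c,d\}]$ is not an induced $P_4$. $V(H)=B_1\cup\dots\cup B_5$ and $\mathrm{supp}(v)=\{i\in\{1,\dots,5\}: N(v)\cap B_i\neq\emptyset\}$. -}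

module Defs where

open import Data.Nat using (ℕ; zero; suc; _<_; _≤_)
open import Data.Fin using (Fin; zero; suc; toℕ)
open import Data.Fin.Subset using (Subset; _∈_; _∉_; ∣_∣)
open import Data.Fin.Subset.Properties using (_∈?_)
open import Data.Fin.Properties using (any?)
open import Data.Vec using (tabulate)
open import Data.Product using (Σ; ∃; ∃-syntax; _×_; _,_)
open import Data.Sum using (_⊎_)
open import Data.List using (List; _∷_; [])
open import Data.List.Membership.Propositional using () renaming (_∈_ to _∈ₗ_)
open import Relation.Nullary using (¬_; Dec; does)
open import Relation.Nullary.Decidable using (_×-dec_)
open import Relation.Binary using (Decidable)
open import Relation.Binary.PropositionalEquality using (_≡_; _≢_)
open import Function using (_⇔_)
open import Function.Definitions using (Injective)

record Graph (n : ℕ) : Set₁ where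
  field
    Adj    : Fin n → Fin n → Set
    adj?   : Decidable Adj
    sym    : ∀ {u v} → Adj u v → Adj v u
    irrefl : ∀ {v} → ¬ Adj v v
open Graph public

PathAdj : (k : ℕ) → Fin k → Fin k → Set
PathAdj k i j = (toℕ j ≡ suc (toℕ i)) ⊎ (toℕ i ≡ suc (toℕ j))

CycleAdj : (k : ℕ) → Fin k → Fin k → Set
CycleAdj k i j =
  PathAdj k i j
  ⊎ ((suc (toℕ i) ≡ k × toℕ j ≡ 0) ⊎ (suc (toℕ j) ≡ k × toℕ i ≡ 0))

HasInduced : ∀ {n} → Graph n → (k : ℕ) → (Fin k → Fin k → Set) → Set
HasInduced {n} G k R =
  Σ (Fin k → Fin n) λ f → Injective _≡_ _≡_ f × (∀ i j → Adj G (f i) (f j) ⇔ R i j)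

HasInducedP : ∀ {n} → Graph n → ℕ → Set
HasInducedP G k = HasInduced G k (PathAdj k)

HasInducedC : ∀ {n} → Graph n → ℕ → Set
HasInducedC G k = HasInduced G k (CycleAdj k)

InducedP4On : ∀ {n} → Graph n → List (Fin n) → Set
InducedP4On {n} G S =
  Σ (Fin 4 → Fin n) λ f →
    Injective _≡_ _≡_ f
    × (∀ i → f i ∈ₗ S)
    × (∀ x → x ∈ₗ S → ∃[ i ] f i ≡ x)
    × (∀ i j → Adj G (f i) (f j) ⇔ PathAdj 4 i j)

-- Indices modulo 5 (index 1..5 of the paper ↦ Fin 5).
next : Fin 5 → Fin 5
next zero = suc zero
next (suc zero) = suc (suc zero)
next (suc (suc zero)) = suc (suc (suc zero))
next (suc (suc (suc zero))) = suc (suc (suc (suc zero)))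
next (suc (suc (suc (suc zero)))) = zero

prev : Fin 5 → Fin 5
prev zero = suc (suc (suc (suc zero)))
prev (suc zero) = zero
prev (suc (suc zero)) = suc zero
prev (suc (suc (suc zero))) = suc (suc zero)
prev (suc (suc (suc (suc zero)))) = suc (suc (suc zero))

shift : ℕ → Fin 5 → Fin 5
shift zero i = i
shift (suc j) i = next (shift j i)

record NiceBlowup {n} (G : Graph n) (B : Fin 5 → Subset n) : Set where
  field
    disjoint  : ∀ i j → i ≢ j → ∀ v → v ∈ B i → v ∉ B j
    nonempty  : ∀ i → ∃[ v ] v ∈ B i
    clique    : ∀ i u v → u ∈ B i → v ∈ B i → u ≢ v → Adj G u v
    nbrPrev   : ∀ i v → v ∈ B i → ∃[ u ] (u ∈ B (prev i) × Adj G v u)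
    nbrNext   : ∀ i v → v ∈ B i → ∃[ u ] (u ∈ B (next i) × Adj G v u)
    noEdge2   : ∀ i u v → u ∈ B i → v ∈ B (next (next i)) → ¬ Adj G u v
    noP4      : ∀ i a b c d → a ∈ B i → b ∈ B (next i) → c ∈ B (next i) → b ≢ c
                → d ∈ B (next (next i)) → ¬ InducedP4On G (a ∷ b ∷ c ∷ d ∷ [])

InBlowup : ∀ {n} → (Fin 5 → Subset n) → Fin n → Set
InBlowup B v = ∃[ i ] v ∈ B i

supp : ∀ {n} → Graph n → (Fin 5 → Subset n) → Fin n → Subset 5
supp G B v = tabulate λ i → does (any? λ u → (u ∈? B i) ×-dec adj? G v u)

Consecutive : Subset 5 → Set
Consecutive S =
  (∀ i → i ∉ S)
  ⊎ Σ (Fin 5) λ s → Σ ℕ λ k → 1 ≤ k × k ≤ 5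
      × (∀ i → (i ∈ S) ⇔ (∃[ j ] (j < k × shift j s ≡ i)))

{-# OPTIONS --safe #-}
-- If v sees bags B i and B (i+2) but not B (i+1), pick a neighbour b ∈ B (i+1) of the
-- vertex a that v sees in B i, and a neighbour b′ ∈ B (i+1) of the vertex c that v sees
-- in B (i+2).  Then v a b c or v a b′ c is an induced C4, or else a b b′ c is an induced
-- P4 across three consecutive bags, which niceness forbids.  So supp(v) is a subset of
-- ℤ/5 without gaps of length one; by inspection of the 32 subsets these are exactly the
-- cyclic intervals of length 0, 1, 2, 3 and 5 (an interval of length 4 omits only i+4 but
-- contains i+3 and i+3+2 = i).
module Submission where

open import Defs
open import Data.Bool using (true; if_then_else_)
open import Data.Bool.Properties using () renaming (_≟_ to _≟ᵇ_)
open import Data.Empty using (⊥; ⊥-elim)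
open import Data.Fin as Fin using (Fin; zero; suc; toℕ)
open import Data.Fin.Properties using (any?; all?; toℕ<n; <-cmp)
open import Data.Fin.Subset using (Subset; _∈_; _∉_; _∪_; ⁅_⁆; ∣_∣) renaming (⊥ to ∅)
open import Data.Fin.Subset.Properties
  using (_∈?_; anySubset?; ∉⊥; x∈p∪q⁻; x∈p∪q⁺; x∈⁅x⁆; x∈⁅y⁆⇒x≡y)
open import Data.List using (_∷_; []; lookup)
open import Data.List.Membership.Propositional.Properties using (∈-lookup)
open import Data.List.Relation.Unary.Any using (index)
open import Data.List.Relation.Unary.Any.Properties using (lookup-index)
open import Data.Nat using (ℕ; zero; suc; _+_; _<_; _≟_; s≤s; z≤n)
open import Data.Nat.Properties
  using (1+n≢n; 0≢1+n; suc-injective; m<1+n⇒m<n∨m≡n; m<n⇒m<1+n; n<1+n)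
open import Data.Product using (∃-syntax; Σ-syntax; _×_; _,_)
open import Data.Sum as Sum using (_⊎_; inj₁; inj₂; swap; [_,_])
open import Data.Vec using (tabulate)
open import Data.Vec.Properties using (≡-dec; lookup∘tabulate; []=⇒lookup; lookup⇒[]=)
open import Function using (_⇔_; mk⇔; Equivalence; _∘_; const; flip)
open import Function.Definitions using (Injective)
open import Relation.Binary using (Decidable; tri<; tri≈; tri>)
open import Relation.Binary.PropositionalEquality as ≡ using (_≡_; _≢_; refl)
open import Relation.Nullary using (¬_; Dec; yes; no; does; proof; contradiction)
open import Relation.Nullary.Decidable
  using (_×-dec_; _⊎-dec_; _→-dec_; ¬?; from-no; decidable-stable; dec-true)
open import Relation.Nullary.Reflects using (Reflects; invert)
open import Relation.Unary using (Pred)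
import Relation.Unary as U

interval : Fin 5 → ℕ → Subset 5
interval s zero    = ∅
interval s (suc k) = interval s k ∪ ⁅ shift k s ⁆

∈-interval : ∀ s k i → i ∈ interval s k ⇔ (∃[ j ] (j < k × shift j s ≡ i))
∈-interval s zero    i = mk⇔ (⊥-elim ∘ ∉⊥) λ ()
∈-interval s (suc k) i = mk⇔ to from
  where
  to : i ∈ interval s (suc k) → ∃[ j ] (j < suc k × shift j s ≡ i)
  to i∈ with x∈p∪q⁻ (interval s k) ⁅ shift k s ⁆ i∈
  ... | inj₁ i∈s,k with (j , j<k , eq) ← Equivalence.to (∈-interval s k i) i∈s,k =
    j , m<n⇒m<1+n j<k , eq
  ... | inj₂ i∈⁅⁆ = k , n<1+n k , ≡.sym (x∈⁅y⁆⇒x≡y _ i∈⁅⁆)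
  from : ∃[ j ] (j < suc k × shift j s ≡ i) → i ∈ interval s (suc k)
  from (j , j<1+k , refl) with m<1+n⇒m<n∨m≡n j<1+k
  ... | inj₁ j<k  = x∈p∪q⁺ (inj₁ (Equivalence.from (∈-interval s k _) (j , j<k , refl)))
  ... | inj₂ refl = x∈p∪q⁺ {p = interval s k} (inj₂ (x∈⁅x⁆ (shift j s)))

-- The length 1 + k ranges over 1 … 5 through k : Fin 5, so that isInterval? is a finite search.
IsInterval : Subset 5 → Set
IsInterval S = S ≡ ∅ ⊎ ∃[ s ] Σ[ k ∈ Fin 5 ] S ≡ interval s (suc (toℕ k))

isInterval? : ∀ S → Dec (IsInterval S)
isInterval? S =
  ≡-dec _≟ᵇ_ S ∅ ⊎-dec any? λ s → any? λ k → ≡-dec _≟ᵇ_ S (interval s (suc (toℕ k)))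

isInterval⇒consecutive : ∀ S → IsInterval S → Consecutive S
isInterval⇒consecutive S (inj₁ refl) = inj₁ λ i → ∉⊥
isInterval⇒consecutive S (inj₂ (s , k , refl)) =
  inj₂ (s , suc (toℕ k) , s≤s z≤n , toℕ<n k , ∈-interval s (suc (toℕ k)))

AdmissibleSize : ℕ → Set
AdmissibleSize m = m ≡ 0 ⊎ m ≡ 1 ⊎ m ≡ 2 ⊎ m ≡ 3 ⊎ m ≡ 5

admissibleSize? : ∀ m → Dec (AdmissibleSize m)
admissibleSize? m = m ≟ 0 ⊎-dec m ≟ 1 ⊎-dec m ≟ 2 ⊎-dec m ≟ 3 ⊎-dec m ≟ 5

GapClosed : Subset 5 → Set
GapClosed S = ∀ i → i ∈ S → next (next i) ∈ S → next i ∈ S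

gapClosed? : ∀ S → Dec (GapClosed S)
gapClosed? S = all? λ i → (i ∈? S) →-dec ((next (next i) ∈? S) →-dec (next i ∈? S))

gapClosed⇒interval : ∀ S → GapClosed S → IsInterval S × AdmissibleSize ∣ S ∣
gapClosed⇒interval S closed =
  decidable-stable (isInterval? S ×-dec admissibleSize? ∣ S ∣) λ bad →
    noCounterexample (S , closed , bad)
  where
  noCounterexample : ¬ (∃[ S ] (GapClosed S × ¬ (IsInterval S × AdmissibleSize ∣ S ∣)))
  noCounterexample = from-no (anySubset? λ S →
    gapClosed? S ×-dec ¬? (isInterval? S ×-dec admissibleSize? ∣ S ∣))

pathAdj? : ∀ k → Decidable (PathAdj k)
pathAdj? k i j = (toℕ j ≟ suc (toℕ i)) ⊎-dec (toℕ i ≟ suc (toℕ j))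

pathAdj-sym : ∀ {k i j} → PathAdj k i j → PathAdj k j i
pathAdj-sym = swap

pathAdj-irrefl : ∀ {k i} → ¬ PathAdj k i i
pathAdj-irrefl (inj₁ eq) = 1+n≢n (≡.sym eq)
pathAdj-irrefl (inj₂ eq) = 1+n≢n (≡.sym eq)

cycleAdj? : ∀ k → Decidable (CycleAdj k)
cycleAdj? k i j = pathAdj? k i j
  ⊎-dec ((suc (toℕ i) ≟ k) ×-dec (toℕ j ≟ 0) ⊎-dec (suc (toℕ j) ≟ k) ×-dec (toℕ i ≟ 0))

cycleAdj-sym : ∀ {k i j} → CycleAdj k i j → CycleAdj k j i
cycleAdj-sym = Sum.map pathAdj-sym swap

cycleAdj-irrefl : ∀ {m i} → ¬ CycleAdj (2 + m) i i
cycleAdj-irrefl     (inj₁ p)    = pathAdj-irrefl p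
cycleAdj-irrefl {m} (inj₂ wrap) = [ noLoop , noLoop ] wrap
  where
  noLoop : ∀ {i} → ¬ (suc (toℕ i) ≡ 2 + m × toℕ i ≡ 0)
  noLoop (wraps , i≡0) = 0≢1+n (suc-injective (≡.trans (≡.cong suc (≡.sym i≡0)) wraps))

module _ {n} (G : Graph n) {k} {R : Fin k → Fin k → Set}
         (R? : Decidable R) (f : Fin k → Fin n) where

  -- Distinctness is only demanded at non-edges: adjacent vertices are distinct by irreflexivity.
  Realised : (i j : Fin k) → Dec (R i j) → Set
  Realised i j d = if does d then Adj G (f i) (f j) else (¬ Adj G (f i) (f j) × f i ≢ f j)

  module _ (R-sym : ∀ {i j} → R i j → R j i) (R-irrefl : ∀ {i} → ¬ R i i)
           (realised : ∀ {i j} → i Fin.< j → Realised i j (R? i j)) where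

    private
      realised⇒⇔ : ∀ {i j} (d : Dec (R i j)) → Realised i j d → Adj G (f i) (f j) ⇔ R i j
      realised⇒⇔ (yes r)  edge          = mk⇔ (const r) (const edge)
      realised⇒⇔ (no ¬r) (nonEdge , _) = mk⇔ (flip contradiction nonEdge) (flip contradiction ¬r)

      realised⇒≢ : ∀ {i j} (d : Dec (R i j)) → Realised i j d → f i ≢ f j
      realised⇒≢ (yes _) edge     eq = irrefl G (≡.subst (Adj G _) (≡.sym eq) edge)
      realised⇒≢ (no _)  (_ , ≢) = ≢

    inducedAdj : ∀ i j → Adj G (f i) (f j) ⇔ R i j
    inducedAdj i j with <-cmp i j
    ... | tri< i<j _ _ = realised⇒⇔ (R? i j) (realised i<j)
    ... | tri≈ _ refl _ = mk⇔ (⊥-elim ∘ irrefl G) (⊥-elim ∘ R-irrefl)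
    ... | tri> _ _ j<i = mk⇔ (R-sym ∘ to ∘ sym G) (sym G ∘ from ∘ R-sym)
      where open Equivalence (realised⇒⇔ (R? j i) (realised j<i))

    inducedInjective : Injective _≡_ _≡_ f
    inducedInjective {i} {j} eq with <-cmp i j
    ... | tri< i<j _ _ = contradiction eq (realised⇒≢ (R? i j) (realised i<j))
    ... | tri≈ _ i≡j _ = i≡j
    ... | tri> _ _ j<i = contradiction (≡.sym eq) (realised⇒≢ (R? j i) (realised j<i))

    induced : HasInduced G k R
    induced = f , inducedInjective , inducedAdj

Fin4-<-elim : {P : Fin 4 → Fin 4 → Set}
            → P zero (suc zero) → P zero (suc (suc zero)) → P zero (suc (suc (suc zero)))
            → P (suc zero) (suc (suc zero)) → P (suc zero) (suc (suc (suc zero)))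
            → P (suc (suc zero)) (suc (suc (suc zero)))
            → ∀ {i j} → i Fin.< j → P i j
Fin4-<-elim {P} p₀₁ p₀₂ p₀₃ p₁₂ p₁₃ p₂₃ = go
  where
  go : ∀ {i j} → i Fin.< j → P i j
  go {zero} {zero} ()
  go {zero} {suc zero} _ = p₀₁
  go {zero} {suc (suc zero)} _ = p₀₂
  go {zero} {suc (suc (suc zero))} _ = p₀₃
  go {suc _} {zero} ()
  go {suc zero} {suc zero} (s≤s ())
  go {suc zero} {suc (suc zero)} _ = p₁₂
  go {suc zero} {suc (suc (suc zero))} _ = p₁₃
  go {suc (suc _)} {suc zero} (s≤s ())
  go {suc (suc zero)} {suc (suc zero)} (s≤s (s≤s ()))
  go {suc (suc zero)} {suc (suc (suc zero))} _ = p₂₃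
  go {suc (suc (suc _))} {suc (suc zero)} (s≤s (s≤s ()))
  go {suc (suc (suc zero))} {suc (suc (suc zero))} (s≤s (s≤s (s≤s ())))

module _ {n} (G : Graph n) {w₀ w₁ w₂ w₃ : Fin n} where

  private
    w : Fin 4 → Fin n
    w = lookup (w₀ ∷ w₁ ∷ w₂ ∷ w₃ ∷ [])

  inducedC4 : Adj G w₀ w₁ → Adj G w₁ w₂ → Adj G w₂ w₃ → Adj G w₃ w₀
            → ¬ Adj G w₀ w₂ → ¬ Adj G w₁ w₃ → w₀ ≢ w₂ → w₁ ≢ w₃
            → HasInducedC G 4
  inducedC4 e₀₁ e₁₂ e₂₃ e₃₀ ¬e₀₂ ¬e₁₃ w₀≢w₂ w₁≢w₃ =
    induced G (cycleAdj? 4) w cycleAdj-sym cycleAdj-irrefl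
      (Fin4-<-elim {λ i j → Realised G (cycleAdj? 4) w i j (cycleAdj? 4 i j)}
         e₀₁ (¬e₀₂ , w₀≢w₂) (sym G e₃₀) e₁₂ (¬e₁₃ , w₁≢w₃) e₂₃)

  inducedP4On : Adj G w₀ w₁ → Adj G w₁ w₂ → Adj G w₂ w₃
              → ¬ Adj G w₀ w₂ → ¬ Adj G w₀ w₃ → ¬ Adj G w₁ w₃ → w₀ ≢ w₂ → w₀ ≢ w₃ → w₁ ≢ w₃
              → InducedP4On G (w₀ ∷ w₁ ∷ w₂ ∷ w₃ ∷ [])
  inducedP4On e₀₁ e₁₂ e₂₃ ¬e₀₂ ¬e₀₃ ¬e₁₃ w₀≢w₂ w₀≢w₃ w₁≢w₃ =
    w , inducedInjective G (pathAdj? 4) w pathAdj-sym pathAdj-irrefl realised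
      , ∈-lookup , (λ _ u∈ → index u∈ , ≡.sym (lookup-index u∈))
      , inducedAdj G (pathAdj? 4) w pathAdj-sym pathAdj-irrefl realised
    where
    realised : ∀ {i j} → i Fin.< j → Realised G (pathAdj? 4) w i j (pathAdj? 4 i j)
    realised = Fin4-<-elim {λ i j → Realised G (pathAdj? 4) w i j (pathAdj? 4 i j)}
      e₀₁ (¬e₀₂ , w₀≢w₂) (¬e₀₃ , w₀≢w₃) e₁₂ (¬e₁₃ , w₁≢w₃) e₂₃

∈-tabulate-does : ∀ {m ℓ} {P : Pred (Fin m) ℓ} (P? : U.Decidable P) i
                → i ∈ tabulate (does ∘ P?) ⇔ P i
∈-tabulate-does {P = P} P? i = mk⇔
  (λ i∈ → invert (≡.subst (Reflects (P i)) (lookup-does i∈) (proof (P? i))))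
  (λ p → lookup⇒[]= i _ (≡.trans (lookup∘tabulate _ i) (dec-true (P? i) p)))
  where
  lookup-does : i ∈ tabulate (does ∘ P?) → does (P? i) ≡ true
  lookup-does i∈ = ≡.trans (≡.sym (lookup∘tabulate _ i)) ([]=⇒lookup i∈)

∈-supp : ∀ {n} (G : Graph n) B v i → i ∈ supp G B v ⇔ (∃[ u ] (u ∈ B i × Adj G v u))
∈-supp G B v = ∈-tabulate-does λ i → any? λ u → (u ∈? B i) ×-dec adj? G v u

prev∘next : ∀ i → prev (next i) ≡ i
prev∘next zero = refl
prev∘next (suc zero) = refl
prev∘next (suc (suc zero)) = refl
prev∘next (suc (suc (suc zero))) = refl
prev∘next (suc (suc (suc (suc zero)))) = refl

i≢next²i : ∀ i → i ≢ next (next i)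
i≢next²i zero ()
i≢next²i (suc zero) ()
i≢next²i (suc (suc zero)) ()
i≢next²i (suc (suc (suc zero))) ()
i≢next²i (suc (suc (suc (suc zero)))) ()

module _ {n} {G : Graph n} {B : Fin 5 → Subset n}
         (nice : NiceBlowup G B) (noC4 : ¬ HasInducedC G 4) where
  open NiceBlowup nice

  private
    noSkippedBagVia : ∀ {v i a b b′ c} → v ∉ B (next i)
                    → a ∈ B i → b ∈ B (next i) → b′ ∈ B (next i) → c ∈ B (next (next i))
                    → Adj G v a → Adj G a b → Adj G b′ c → Adj G c v
                    → ¬ (∀ {u} → u ∈ B (next i) → ¬ Adj G v u)
    noSkippedBagVia {v} {i} {a} {b} {b′} {c} v∉ a∈ b∈ b′∈ c∈ va ab b′c cv v≁ =
      split (adj? G b c) (adj? G a b′)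
      where
      a≁c : ¬ Adj G a c
      a≁c = noEdge2 i a c a∈ c∈
      a≢c : a ≢ c
      a≢c refl = disjoint i (next (next i)) (i≢next²i i) a a∈ c∈
      v≢ : ∀ {u} → u ∈ B (next i) → v ≢ u
      v≢ u∈ refl = v∉ u∈
      split : Dec (Adj G b c) → Dec (Adj G a b′) → ⊥
      split (yes bc) _ = noC4 (inducedC4 G va ab bc cv (v≁ b∈) a≁c (v≢ b∈) a≢c)
      split (no _) (yes ab′) = noC4 (inducedC4 G va ab′ b′c cv (v≁ b′∈) a≁c (v≢ b′∈) a≢c)
      split (no b≁c) (no a≁b′) = noP4 i a b b′ c a∈ b∈ b′∈ b≢b′ c∈
          (inducedP4On G ab (clique (next i) b b′ b∈ b′∈ b≢b′) b′c a≁b′ a≁c b≁c a≢b′ a≢c b≢c)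
        where
        b≢b′ : b ≢ b′
        b≢b′ refl = b≁c b′c
        a≢b′ : a ≢ b′
        a≢b′ refl = a≁c b′c
        b≢c : b ≢ c
        b≢c refl = a≁c ab

  noSkippedBag : ∀ {v i a c} → v ∉ B (next i) → a ∈ B i → c ∈ B (next (next i))
               → Adj G v a → Adj G v c
               → ¬ (∀ {b} → b ∈ B (next i) → ¬ Adj G v b)
  noSkippedBag {i = i} {a} {c} v∉ a∈ c∈ va vc
    with b , b∈ , ab ← nbrNext i a a∈ | b′ , b′∈ , cb′ ← nbrPrev (next (next i)) c c∈ =
    noSkippedBagVia v∉ a∈ b∈ (≡.subst (λ j → b′ ∈ B j) (prev∘next (next i)) b′∈) c∈
      va ab (sym G cb′) (sym G vc)

  supp-gapClosed : ∀ {v} → ¬ InBlowup B v → GapClosed (supp G B v)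
  supp-gapClosed {v} v∉H i i∈ i+2∈ = decidable-stable (next i ∈? supp G B v) λ i+1∉ →
    let a , a∈ , va = Equivalence.to (∈-supp G B v i) i∈
        c , c∈ , vc = Equivalence.to (∈-supp G B v (next (next i))) i+2∈
    in noSkippedBag (v∉H ∘ (next i ,_)) a∈ c∈ va vc
         λ b∈ vb → i+1∉ (Equivalence.from (∈-supp G B v (next i)) (_ , b∈ , vb))

lemma4p2 : (n : ℕ) (G : Graph n) (B : Fin 5 → Subset n)
    → ¬ HasInducedP G 7 → ¬ HasInducedC G 4 → ¬ HasInducedC G 6 → ¬ HasInducedC G 7
    → NiceBlowup G B
    → (v : Fin n) → ¬ InBlowup B v
    → Consecutive (supp G B v)
      × (∣ supp G B v ∣ ≡ 0 ⊎ ∣ supp G B v ∣ ≡ 1 ⊎ ∣ supp G B v ∣ ≡ 2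
         ⊎ ∣ supp G B v ∣ ≡ 3 ⊎ ∣ supp G B v ∣ ≡ 5)
lemma4p2 n G B _ noC4 _ _ nice v v∉H =
  let isInterval , admissible = gapClosed⇒interval (supp G B v) (supp-gapClosed nice noC4 v∉H)
  in isInterval⇒consecutive (supp G B v) isInterval , admissible
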